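{- Let $G^w=\langle\mathcal V,\mathcal X,\mathcal Y,\rho^e,\rho^s,\varphi,w^s\rangle$ be a weighted game structure, $c\in\mathbb N$, and $G^*$ the game structure constructed from $G^w$ and $c$ as in the context. Let $\psi\in\mathcal L^{env}_\mu$ be a formula all of whose Boolean variables are in $\mathcal V$. Let $\mathcal D$ be a valuation mapping relational variables to $EF(c)$ and $\mathcal E$ a valuation mapping relational variables to sets of states of $G^*$, such that for all relational variables $X$, all $s\in2^{\mathcal V}$ and all $val\in[0,c]$: $val\preceq\mathcal D(X)(s)$ iff $(s,c-val)\in\mathcal E(X)$. Then for all $s\in2^{\mathcal V}$ and $val\in[0,c]$: $val\preceq[\![\psi^E]\!]^{G^w(c)}_{\mathcal D}(s)$ iff $(s,c-val)\in[\![\psi]\!]^{G^*}_{\mathcal E}$.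
   Context: Game structures. A GS $\langle\mathcal V,\mathcal X,\mathcal Y,\rho^e,\rho^s,\varphi\rangle$: $\mathcal V$ finite set of Boolean variables, $\mathcal X\subseteq\mathcal V$ inputs, $\mathcal Y=\mathcal V\setminus\mathcal X$ outputs, states $s\in2^{\mathcal V}$, $p(\cdot)$ maps assignments to primed copies, assignments to disjoint sets combine as tuples; $\rho^e$ over $\mathcal V\cup\mathcal X'$, $\rho^s$ over $\mathcal V\cup\mathcal V'$. A WGS adds a partial weight function $w^s:2^{\mathcal V\cup\mathcal V'}\to\mathbb Z$ on $\rho^s$-transitions. The GS $G^*$: variables $\mathcal V^*=\mathcal X\cup\mathcal Y\cup yDom$, $yDom$ new system variables binary-encoding a value in $[0,c]$; states are pairs $(s,c_1)$, $s\in2^{\mathcal V}$, $c_1\in[0,c]$; $\rho^e$ unchanged; $((s_1,c_1),p(s_2,c_2))\models\rho^{s*}$ iff $(s_1,p(s_2))\models\rho^s$ and $c_1+w^s(s_1,p(s_2))\ge c_2$. $\mu$-calculus. $\psi::=v\mid\neg v\mid X\mid\psi\vee\psi\mid\psi\wedge\psi\mid\Diamond\psi\mid\Box\psi\mid\mu X\psi\mid\nu X\psi$ with the usual set semantics over a GS: $\vee,\wedge$ union/intersection; $[\![\Diamond\phi]\!]$ = states from which every valid input has a valid output leading into $[\![\phi]\!]$; $[\![\Box\phi]\!]$ = states from which some valid input has all valid outputs leading into $[\![\phi]\!]$; $\mu,\nu$ least/greatest fixed points. $\mathcal L^{env}_\mu$: formulas without $\Diamond$. Energy $\mu$-calculus.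 $\psi^E$ replaces $\Box$ by $\Box_E$ (and $\Diamond$ by $\Diamond_E$). $E(c)=\{0,\ldots,c\}\cup\{+\infty\}$, $EF(c)$ = functions $2^{\mathcal V}\to E(c)$, $f_x$ constant. $x\preceq y$ iff $x\ge y$ (so $val\preceq e$ iff $e\neq+\infty$ and $val\ge e$). $EC_c((s,s'),e)$: $0$ if $(s,s')\not\models\rho^e$; else $+\infty$ if $e=+\infty$ or $(s,s')\models\neg\rho^s$; else $+\infty$ if $e-w^s(s,s')>c$; else $\max(0,e-w^s(s,s'))$. $ECpre_{sys}(f)(s)=\max_{s_{\mathcal X}}\min_{s_{\mathcal Y}}EC_c((s,p(s_{\mathcal X},s_{\mathcal Y})),f(s_{\mathcal X},s_{\mathcal Y}))$. Negation: $\sim0=+\infty$, $\sim(+\infty)=0$, $\sim x=c+1-x$ otherwise, pointwise. Semantics $[\![\cdot]\!]^{G^w(c)}_{\mathcal D}\in EF(c)$: $[\![v]\!](s)=0$ if $s\models v$, else $+\infty$; $[\![\neg v]\!](s)=+\infty$ if $s\models v$, else $0$; $[\![X]\!]=\mathcal D(X)$; $\vee$ pointwise min; $\wedge$ pointwise max; $[\![\Box_E\phi]\!]=\sim ECpre_{sys}(\sim[\![\phi]\!])$; $[\![\mu X\phi]\!]=\min_ih_i$ with $h_0=f_{+\infty}$, $h_{i+1}=[\![\phi]\!]_{\mathcal D[X\mapsto h_i]}$; $[\![\nu X\phi]\!]=\max_ih_i$ with $h_0=f_0$. -}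

module Defs where

open import Data.Nat as ℕ using (ℕ; zero; suc; _≤?_; _<_; s≤s)
open import Data.Nat.Properties using (≤-<-trans; n<1+n)
open import Data.Integer as ℤ using (ℤ; +_; -[1+_]; _-_; _+_; _≥_)
open import Data.Fin as Fin using (Fin; zero; suc; toℕ; fromℕ<; opposite; inject₁)
open import Data.Bool using (Bool; true; false; if_then_else_; not; T)
open import Data.Vec using (Vec; []; _∷_; lookup)
open import Data.List using (List; []; _∷_; map; _++_; foldr)
open import Data.Sum using (_⊎_; inj₁; inj₂)
open import Data.Product using (_×_; _,_; proj₁; proj₂; Σ; ∃)
open import Level using (Level)
open import Data.Empty using (⊥)
open import Data.Unit using (⊤)
open import Relation.Nullary using (yes; no; ¬_)
open import Relation.Binary.PropositionalEquality using (_≡_)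

-- V = X ⊎ Y with |X| = nx (inputs) and |Y| = ny (outputs).
-- A state s ∈ 2^V is a pair (assignment to X , assignment to Y);
-- combining assignments to disjoint sets is tupling.

Var : ℕ → ℕ → Set
Var nx ny = Fin nx ⊎ Fin ny

State : ℕ → ℕ → Set
State nx ny = Vec Bool nx × Vec Bool ny

_⊨_ : ∀ {nx ny} → State nx ny → Var nx ny → Bool
(sx , sy) ⊨ inj₁ i = lookup sx i
(sx , sy) ⊨ inj₂ j = lookup sy j

allVecs : (n : ℕ) → List (Vec Bool n)
allVecs zero    = [] ∷ []
allVecs (suc n) = map (true ∷_) (allVecs n) ++ map (false ∷_) (allVecs n)

-- Weighted game structure (the winning condition φ plays no role in
-- the lemma and is omitted).
--   ρe s x'  : transition s → next inputs x'   (formula over V ∪ X')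
--   ρs s s'  : transition s → next state s'    (formula over V ∪ V')
--   w  s s'  : weight; only consulted on ρs-transitions (partiality)

record WGS (nx ny : ℕ) : Set where
  field
    ρe : State nx ny → Vec Bool nx → Bool
    ρs : State nx ny → State nx ny → Bool
    w  : State nx ny → State nx ny → ℤ

-- μ-calculus formulas of L^env_μ (no ◇) whose Boolean variables are in V.
-- Relational variables are named by ℕ.  The same syntax is read as ψ
-- (over G*) and as ψ^E (□ read as □_E, over G^w(c)).

data Formula (nx ny : ℕ) : Set where
  var  : Var nx ny → Formula nx ny
  nvar : Var nx ny → Formula nx ny
  rvar : ℕ → Formula nx ny
  _∨_  : Formula nx ny → Formula nx ny → Formula nx ny
  _∧_  : Formula nx ny → Formula nx ny → Formula nx ny
  □    : Formula nx ny → Formula nx ny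
  μ    : ℕ → Formula nx ny → Formula nx ny
  ν    : ℕ → Formula nx ny → Formula nx ny

_[_↦_] : ∀ {a} {A : Set a} → (ℕ → A) → ℕ → A → (ℕ → A)
(D [ X ↦ h ]) Y with Y ℕ.≟ X
... | yes _ = h
... | no  _ = D Y

data En (c : ℕ) : Set where
  val : Fin (suc c) → En c
  inf : En c

_≤E_ : ∀ {c} → En c → En c → Set
val a ≤E val b = toℕ a ℕ.≤ toℕ b
val a ≤E inf   = ⊤
inf   ≤E val b = ⊥
inf   ≤E inf   = ⊤

minE : ∀ {c} → En c → En c → En c
minE (val a) (val b) with toℕ a ≤? toℕ b
... | yes _ = val a
... | no  _ = val b
minE (val a) inf = val a
minE inf e = e

maxE : ∀ {c} → En c → En c → En c
maxE (val a) (val b) with toℕ a ≤? toℕ b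
... | yes _ = val b
... | no  _ = val a
maxE (val a) inf = inf
maxE inf e = inf

_⪯_ : ∀ {c} → Fin (suc c) → En c → Set
v ⪯ val e = toℕ e ℕ.≤ toℕ v
v ⪯ inf   = ⊥

-- negation: ~0 = +∞, ~+∞ = 0, ~x = c+1-x otherwise
-- (for x = suc y, opposite (inject₁ y) has value c - y = c + 1 - x)
~_ : ∀ {c} → En c → En c
~ inf           = val zero
~ val zero      = inf
~ val (suc y)   = val (opposite (inject₁ y))

EF : ℕ → ℕ → ℕ → Set
EF c nx ny = State nx ny → En c

-- c - val, for val ∈ [0,c]   (toℕ (opposite v) = c ∸ toℕ v)
cminus : ∀ {c} → Fin (suc c) → Fin (suc c)
cminus v = opposite v

-- the value "+∞ if d > c, else max(0,d)" for d = e - w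
clampE : (c : ℕ) → ℤ → En c
clampE c -[1+ n ] = val zero
clampE c (+ n) with n ≤? c
... | yes n≤c = val (fromℕ< (s≤s n≤c))
... | no  _   = inf

module Energy {nx ny : ℕ} (c : ℕ) (G : WGS nx ny) where
  open WGS G

  EC : State nx ny → State nx ny → En c → En c
  EC s s' e =
    if not (ρe s (proj₁ s')) then val zero
    else (case-e e)
    where
      case-e : En c → En c
      case-e inf = inf
      case-e (val e') =
        if not (ρs s s') then inf
        else clampE c ((+ toℕ e') - w s s')

  maxL : List (En c) → En c
  maxL = foldr maxE (val zero)

  minL : List (En c) → En c
  minL = foldr minE inf

  ECpre : EF c nx ny → EF c nx ny
  ECpre f s =
    maxL (map (λ sx → minL (map (λ sy → EC s (sx , sy) (f (sx , sy)))
                                 (allVecs ny)))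
              (allVecs nx))

  IsMin : (ℕ → EF c nx ny) → EF c nx ny → Set
  IsMin h f = ∀ s → Σ ℕ (λ i → f s ≡ h i s) × (∀ i → f s ≤E h i s)

  IsMax : (ℕ → EF c nx ny) → EF c nx ny → Set
  IsMax h f = ∀ s → Σ ℕ (λ i → f s ≡ h i s) × (∀ i → h i s ≤E f s)

  ValE : Set
  ValE = ℕ → EF c nx ny

  -- SemE ψ D f  :  f = ⟦ψ^E⟧^{G^w(c)}_D  (as a relation, pointwise)
  data SemE : Formula nx ny → ValE → EF c nx ny → Set where
    s-var  : ∀ {v D f} →
      (∀ s → f s ≡ (if s ⊨ v then val zero else inf)) → SemE (var v) D f
    s-nvar : ∀ {v D f} →
      (∀ s → f s ≡ (if s ⊨ v then inf else val zero)) → SemE (nvar v) D f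
    s-rvar : ∀ {X D f} →
      (∀ s → f s ≡ D X s) → SemE (rvar X) D f
    s-or   : ∀ {a b D f g h} → SemE a D f → SemE b D g →
      (∀ s → h s ≡ minE (f s) (g s)) → SemE (a ∨ b) D h
    s-and  : ∀ {a b D f g h} → SemE a D f → SemE b D g →
      (∀ s → h s ≡ maxE (f s) (g s)) → SemE (a ∧ b) D h
    s-box  : ∀ {a D f h} → SemE a D f →
      (∀ s → h s ≡ ~ (ECpre (λ t → ~ (f t)) s)) → SemE (□ a) D h
    s-mu   : ∀ {X φ D f} (h : ℕ → EF c nx ny) →
      (∀ s → h 0 s ≡ inf) →
      (∀ i → SemE φ (D [ X ↦ h i ]) (h (suc i))) →
      IsMin h f → SemE (μ X φ) D f
    s-nu   : ∀ {X φ D f} (h : ℕ → EF c nx ny) →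
      (∀ s → h 0 s ≡ val zero) →
      (∀ i → SemE φ (D [ X ↦ h i ]) (h (suc i))) →
      IsMax h f → SemE (ν X φ) D f

module Star {nx ny : ℕ} (c : ℕ) (G : WGS nx ny) where
  open WGS G

  State* : Set
  State* = State nx ny × Fin (suc c)

  ρs* : State* → State* → Set
  ρs* (s₁ , c₁) (s₂ , c₂) =
    T (ρs s₁ s₂) × ((+ toℕ c₁) + w s₁ s₂ ≥ (+ toℕ c₂))

  ρe* : State* → Vec Bool nx → Set
  ρe* (s , c₁) x' = T (ρe s x')

  ValS : Set₁
  ValS = ℕ → State* → Set

  -- membership in ⟦ψ⟧^{G*}_E ; fixed points by iteration from ∅ / all
  -- (equal to least / greatest fixed points, the state space being finite)
  ⟦_⟧ : Formula nx ny → ValS → State* → Set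
  ⟦ var v ⟧  E (s , _) = T (s ⊨ v)
  ⟦ nvar v ⟧ E (s , _) = T (not (s ⊨ v))
  ⟦ rvar X ⟧ E t = E X t
  ⟦ a ∨ b ⟧  E t = ⟦ a ⟧ E t ⊎ ⟦ b ⟧ E t
  ⟦ a ∧ b ⟧  E t = ⟦ a ⟧ E t × ⟦ b ⟧ E t
  ⟦ □ a ⟧    E t =
    Σ (Vec Bool nx) λ x' → ρe* t x' ×
      ((y' : Vec Bool ny) (c₂ : Fin (suc c)) →
        ρs* t ((x' , y') , c₂) → ⟦ a ⟧ E ((x' , y') , c₂))
  ⟦ μ X φ ⟧  E t = Σ ℕ λ i → iterμ i t
    where
      iterμ : ℕ → State* → Set
      iterμ zero    = λ _ → ⊥
      iterμ (suc i) = ⟦ φ ⟧ (E [ X ↦ iterμ i ])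
  ⟦ ν X φ ⟧  E t = (i : ℕ) → iterν i t
    where
      iterν : ℕ → State* → Set
      iterν zero    = λ _ → ⊤
      iterν (suc i) = ⟦ φ ⟧ (E [ X ↦ iterν i ])

{-# OPTIONS --safe #-}
module Submission where

-- Read an energy function f as the set ⟪ f ⟫ of G* states (s , u) with c - u ⪯ f s, and show
-- by induction on ψ that this reading commutes with every construct. Min and max become union
-- and intersection. For □, the negations ~ cancel, and the clamped requirement e - w of EC can be
-- met from level u exactly when every yDom value c₂ ≤ u + w admitted by ρ^{s*} is below e: so
-- ~ ∘ ECpre ∘ ~ becomes the □ of G*. Fixpoint approximants then correspond stage by stage,
-- hence so do their limits.

open import Defs
open import Data.Nat as ℕ using (ℕ; zero; suc; z≤n; s≤s; s≤s⁻¹; _≤?_; _∸_)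
import Data.Nat.Properties as ℕₚ
open import Data.Integer as ℤ using (ℤ; +_; -[1+_]; +<+)
import Data.Integer.Properties as ℤₚ
open import Algebra.Properties.AbelianGroup ℤₚ.+-0-abelianGroup
  using (//-rightDividesˡ; //-rightDividesʳ)
open import Data.Fin using (Fin; zero; suc; toℕ; fromℕ<; opposite; inject₁)
import Data.Fin.Properties as Finₚ
open import Data.Bool using (Bool; true; false; if_then_else_; not; T)
open import Data.Vec using (Vec; []; _∷_; replicate)
open import Data.List using ([]; _∷_; map; foldr)
import Data.List.Relation.Unary.All as All
open All using (All; []; _∷_)
import Data.List.Relation.Unary.Any as Any
open Any using (Any; here)
open import Data.List.Relation.Unary.Any.Properties using (∷↔)
open import Data.List.Membership.Propositional using (_∈_; lose)
open import Data.List.Membership.Propositional.Properties using (∈-map⁺; ∈-++⁺ˡ; ∈-++⁺ʳ)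
open import Data.Sum using (_⊎_; inj₁; inj₂)
open import Data.Sum.Function.Propositional using (_⊎-⇔_)
open import Data.Product using (_×_; _,_; proj₁; proj₂; Σ; ∃; map₂)
open import Data.Product.Function.NonDependent.Propositional using (_×-⇔_)
open import Data.Product.Function.Dependent.Propositional using (Σ-⇔)
open import Data.Empty using (⊥-elim)
open import Data.Unit using (⊤; tt)
open import Relation.Nullary using (¬_; yes; no)
open import Relation.Binary.PropositionalEquality
  using (_≡_; refl; sym; trans; cong; subst; module ≡-Reasoning)
open import Function.Base using (_∘_)
open import Function.Bundles using (_⇔_; mk⇔; Equivalence)
open import Function.Construct.Identity using (↠-id)
import Function.Properties.Equivalence as ⇔
open import Function.Properties.Inverse using (↔⇒⇔)

open Equivalence using (to; from)

Π-⇔ : ∀ {A : Set} {P Q : A → Set} → (∀ a → P a ⇔ Q a) → ((a : A) → P a) ⇔ ((a : A) → Q a)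
Π-⇔ P⇔Q = mk⇔ (λ p a → to (P⇔Q a) (p a)) (λ q a → from (P⇔Q a) (q a))

Π-×-distrib : ∀ {A P : Set} {Q : A → Set} → A → ((a : A) → P × Q a) ⇔ (P × ((a : A) → Q a))
Π-×-distrib a₀ = mk⇔ (λ pq → proj₁ (pq a₀) , proj₂ ∘ pq) (λ (p , q) a → p , q a)

Σℕ⇔Σℕ∘suc : ∀ {B : ℕ → Set} → ¬ B 0 → Σ ℕ B ⇔ Σ ℕ (B ∘ suc)
Σℕ⇔Σℕ∘suc ¬B₀ =
  mk⇔ (λ { (zero , b) → ⊥-elim (¬B₀ b) ; (suc i , b) → i , b }) (λ (i , b) → suc i , b)

Πℕ⇔Πℕ∘suc : ∀ {B : ℕ → Set} → B 0 → ((i : ℕ) → B i) ⇔ ((i : ℕ) → B (suc i))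
Πℕ⇔Πℕ∘suc B₀ = mk⇔ (λ b i → b (suc i)) (λ { b zero → B₀ ; b (suc i) → b i })

m≤n∸k⇔k≤n∸m : ∀ {m n k} → m ℕ.≤ n → k ℕ.≤ n → (m ℕ.≤ n ∸ k) ⇔ (k ℕ.≤ n ∸ m)
m≤n∸k⇔k≤n∸m {n = n} m≤n k≤n = mk⇔ (swap k≤n) (swap m≤n)
  where
  swap : ∀ {a b} → b ℕ.≤ n → a ℕ.≤ n ∸ b → b ℕ.≤ n ∸ a
  swap {a} {b} b≤n a≤n∸b =
    ℕₚ.m+n≤o⇒m≤o∸n b (subst (ℕ._≤ n) (ℕₚ.+-comm a b) (ℕₚ.m≤o∸n⇒m+n≤o a b≤n a≤n∸b))

i<j-k⇔i+k<j : ∀ i j k → (i ℤ.< j ℤ.- k) ⇔ (i ℤ.+ k ℤ.< j)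
i<j-k⇔i+k<j i j k = mk⇔
  (λ i<j-k → subst (i ℤ.+ k ℤ.<_) (//-rightDividesˡ k j) (ℤₚ.+-monoˡ-< k i<j-k))
  (λ i+k<j → subst (ℤ._< j ℤ.- k) (//-rightDividesʳ k i) (ℤₚ.+-monoˡ-< (ℤ.- k) i+k<j))

-- The witness for the backward direction is m itself, which is why m ≤ c is needed.
i<m⇔Fin≤i⇒<m : ∀ {c m} (i : ℤ) → m ℕ.≤ c →
  (i ℤ.< + m) ⇔ (∀ (k : Fin (suc c)) → + toℕ k ℤ.≤ i → toℕ k ℕ.< m)
i<m⇔Fin≤i⇒<m {c} {m} i m≤c =
  mk⇔ (λ i<m k k≤i → ℤₚ.drop‿+<+ (ℤₚ.≤-<-trans k≤i i<m)) below⇒i<m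
  where
  toℕ-m : toℕ (fromℕ< (s≤s m≤c)) ≡ m
  toℕ-m = Finₚ.toℕ-fromℕ< (s≤s m≤c)
  below⇒i<m : (∀ (k : Fin (suc c)) → + toℕ k ℤ.≤ i → toℕ k ℕ.< m) → i ℤ.< + m
  below⇒i<m below with i ℤₚ.<? + m
  ... | yes i<m = i<m
  ... | no  i≮m = ⊥-elim (ℕₚ.<-irrefl toℕ-m
        (below (fromℕ< (s≤s m≤c)) (subst (λ n → + n ℤ.≤ i) (sym toℕ-m) (ℤₚ.≮⇒≥ i≮m))))

opposite-inject₁ : ∀ {n} (i : Fin n) → opposite (inject₁ i) ≡ suc (opposite i)
opposite-inject₁ {suc n} zero    = refl
opposite-inject₁ {suc n} (suc i) = cong inject₁ (opposite-inject₁ i)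

allVecs-complete : ∀ n (v : Vec Bool n) → v ∈ allVecs n
allVecs-complete zero    []          = here refl
allVecs-complete (suc n) (true ∷ v)  = ∈-++⁺ˡ (∈-map⁺ (true ∷_) (allVecs-complete n v))
allVecs-complete (suc n) (false ∷ v) =
  ∈-++⁺ʳ (map (true ∷_) (allVecs n)) (∈-map⁺ (false ∷_) (allVecs-complete n v))

Any-allVecs⇔∃ : ∀ {n} {P : Vec Bool n → Set} → Any P (allVecs n) ⇔ ∃ P
Any-allVecs⇔∃ {n} = mk⇔ Any.satisfied (λ (v , p) → lose (allVecs-complete n v) p)

All-allVecs⇔∀ : ∀ {n} {P : Vec Bool n → Set} → All P (allVecs n) ⇔ (∀ v → P v)
All-allVecs⇔∀ {n} =
  mk⇔ (λ ps v → All.lookup ps (allVecs-complete n v)) (λ p → All.tabulate (λ {v} _ → p v))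

module _ {c : ℕ} where

  infix 4 _<E_
  _<E_ : ℕ → En c → Set
  k <E val a = k ℕ.< toℕ a
  k <E inf   = ⊤

  ⪯-if-zero-inf : ∀ (v : Fin (suc c)) b → (v ⪯ (if b then val zero else inf)) ⇔ T b
  ⪯-if-zero-inf v true  = mk⇔ (λ _ → tt) (λ _ → z≤n)
  ⪯-if-zero-inf v false = mk⇔ (λ ()) (λ ())

  ⪯-if-inf-zero : ∀ (v : Fin (suc c)) b → (v ⪯ (if b then inf else val zero)) ⇔ T (not b)
  ⪯-if-inf-zero v true  = mk⇔ (λ ()) (λ ())
  ⪯-if-inf-zero v false = mk⇔ (λ _ → tt) (λ _ → z≤n)

  ⪯-minE : ∀ (v : Fin (suc c)) a b → (v ⪯ minE a b) ⇔ (v ⪯ a ⊎ v ⪯ b)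
  ⪯-minE v (val a) (val b) with toℕ a ≤? toℕ b
  ... | yes a≤b = mk⇔ inj₁ λ { (inj₁ a≤v) → a≤v ; (inj₂ b≤v) → ℕₚ.≤-trans a≤b b≤v }
  ... | no  a≰b =
    mk⇔ inj₂ λ { (inj₁ a≤v) → ℕₚ.≤-trans (ℕₚ.<⇒≤ (ℕₚ.≰⇒> a≰b)) a≤v ; (inj₂ b≤v) → b≤v }
  ⪯-minE v (val a) inf = mk⇔ inj₁ λ { (inj₁ a≤v) → a≤v ; (inj₂ ()) }
  ⪯-minE v inf     e   = mk⇔ inj₂ λ { (inj₁ ()) ; (inj₂ e≤v) → e≤v }

  ⪯-maxE : ∀ (v : Fin (suc c)) a b → (v ⪯ maxE a b) ⇔ (v ⪯ a × v ⪯ b)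
  ⪯-maxE v (val a) (val b) with toℕ a ≤? toℕ b
  ... | yes a≤b = mk⇔ (λ b≤v → ℕₚ.≤-trans a≤b b≤v , b≤v) proj₂
  ... | no  a≰b = mk⇔ (λ a≤v → a≤v , ℕₚ.≤-trans (ℕₚ.<⇒≤ (ℕₚ.≰⇒> a≰b)) a≤v) proj₁
  ⪯-maxE v (val a) inf = mk⇔ (λ ()) (λ ())
  ⪯-maxE v inf     e   = mk⇔ (λ ()) (λ ())

  ⪯-antitone : ∀ {v : Fin (suc c)} a b → a ≤E b → v ⪯ b → v ⪯ a
  ⪯-antitone (val a) (val b) a≤b b≤v = ℕₚ.≤-trans a≤b b≤v
  ⪯-antitone (val a) inf     _   ()
  ⪯-antitone inf     inf     _   ()

  <E-minE : ∀ k (a b : En c) → (k <E minE a b) ⇔ (k <E a × k <E b)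
  <E-minE k (val a) (val b) with toℕ a ≤? toℕ b
  ... | yes a≤b = mk⇔ (λ k<a → k<a , ℕₚ.<-≤-trans k<a a≤b) proj₁
  ... | no  a≰b = mk⇔ (λ k<b → ℕₚ.<-trans k<b (ℕₚ.≰⇒> a≰b) , k<b) proj₂
  <E-minE k (val a) inf = mk⇔ (λ k<a → k<a , tt) proj₁
  <E-minE k inf     e   = mk⇔ (λ k<e → tt , k<e) proj₂

  <E-maxE : ∀ k (a b : En c) → (k <E maxE a b) ⇔ (k <E a ⊎ k <E b)
  <E-maxE k (val a) (val b) with toℕ a ≤? toℕ b
  ... | yes a≤b = mk⇔ inj₂ λ { (inj₁ k<a) → ℕₚ.<-≤-trans k<a a≤b ; (inj₂ k<b) → k<b }
  ... | no  a≰b = mk⇔ inj₁ λ { (inj₁ k<a) → k<a ; (inj₂ k<b) → ℕₚ.<-trans k<b (ℕₚ.≰⇒> a≰b) }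
  <E-maxE k (val a) inf = mk⇔ inj₂ (λ _ → tt)
  <E-maxE k inf     e   = mk⇔ inj₁ (λ _ → tt)

  <E-foldr-maxE : ∀ {A : Set} k (F : A → En c) xs →
    (k <E foldr maxE (val zero) (map F xs)) ⇔ Any (λ x → k <E F x) xs
  <E-foldr-maxE k F []       = mk⇔ (λ ()) (λ ())
  <E-foldr-maxE k F (x ∷ xs) =
    ⇔.trans (<E-maxE k (F x) _) (⇔.trans (⇔.refl ⊎-⇔ <E-foldr-maxE k F xs) (↔⇒⇔ (∷↔ _)))

  <E-foldr-minE : ∀ {A : Set} k (F : A → En c) xs →
    (k <E foldr minE inf (map F xs)) ⇔ All (λ x → k <E F x) xs
  <E-foldr-minE k F []       = mk⇔ (λ _ → []) (λ _ → tt)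
  <E-foldr-minE k F (x ∷ xs) =
    ⇔.trans (<E-minE k (F x) _)
      (⇔.trans (⇔.refl ×-⇔ <E-foldr-minE k F xs) (mk⇔ (λ (p , ps) → p ∷ ps) All.uncons))

  <E-clampE : ∀ {k} d → k ℕ.≤ c → (k <E clampE c d) ⇔ (+ k ℤ.< d)
  <E-clampE -[1+ n ] _ = mk⇔ (λ ()) (λ ())
  <E-clampE (+ n) k≤c with n ≤? c
  ... | yes n≤c rewrite Finₚ.toℕ-fromℕ< (s≤s n≤c) = mk⇔ +<+ ℤₚ.drop‿+<+
  ... | no  n≰c = mk⇔ (λ _ → +<+ (ℕₚ.≤-<-trans k≤c (ℕₚ.≰⇒> n≰c))) (λ _ → tt)

  ~-involutive : (e : En c) → ~ ~ e ≡ e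
  ~-involutive inf           = refl
  ~-involutive (val zero)    = refl
  ~-involutive (val (suc y)) = begin
    ~ val (opposite (inject₁ y))          ≡⟨ cong (~_ ∘ val) (opposite-inject₁ y) ⟩
    val (opposite (inject₁ (opposite y))) ≡⟨ cong val (opposite-inject₁ (opposite y)) ⟩
    val (suc (opposite (opposite y)))     ≡⟨ cong (val ∘ suc) (Finₚ.opposite-involutive y) ⟩
    val (suc y)                           ∎
    where open ≡-Reasoning

  opposite⪯⇔<E~ : ∀ (u : Fin (suc c)) e → (opposite u ⪯ e) ⇔ (toℕ u <E ~ e)
  opposite⪯⇔<E~ u inf        = mk⇔ (λ ()) (λ ())
  opposite⪯⇔<E~ u (val zero) = mk⇔ (λ _ → tt) (λ _ → z≤n)
  opposite⪯⇔<E~ u (val (suc y))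
    rewrite opposite-inject₁ y | Finₚ.opposite-prop u | Finₚ.opposite-prop y =
    ⇔.trans (m≤n∸k⇔k≤n∸m (Finₚ.toℕ<n y) (Finₚ.toℕ≤pred[n] u)) (mk⇔ s≤s s≤s⁻¹)

  opposite⪯~⇔<E : ∀ (u : Fin (suc c)) e → (opposite u ⪯ (~ e)) ⇔ (toℕ u <E e)
  opposite⪯~⇔<E u e =
    subst (λ e′ → (opposite u ⪯ (~ e)) ⇔ (toℕ u <E e′)) (~-involutive e) (opposite⪯⇔<E~ u (~ e))

module _ {nx ny : ℕ} (c : ℕ) (G : WGS nx ny) where
  open WGS G
  open Energy c G
  open Star c G

  private variable
    f g : EF c nx ny
    h : ℕ → EF c nx ny
    S S′ : State* → Set
    I : ℕ → State* → Set
    F : (State* → Set) → State* → Set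
    D : ValE
    E : ValS

  -- The paper's correspondence "val ⪯ f(s) iff (s , c - val) ∈ S", indexed by u = c - val.
  ⟪_⟫ : EF c nx ny → State* → Set
  ⟪ f ⟫ (s , u) = opposite u ⪯ f s

  Represents : EF c nx ny → (State* → Set) → Set
  Represents f S = ∀ t → ⟪ f ⟫ t ⇔ S t

  RepresentsVal : ValE → ValS → Set
  RepresentsVal D E = ∀ X → Represents (D X) (E X)

  represents⇔cminus : Represents f S ⇔ (∀ s (v : Fin (suc c)) → (v ⪯ f s) ⇔ S (s , cminus v))
  represents⇔cminus {f} {S} = mk⇔
    (λ f~S s v → subst (λ w → (w ⪯ f s) ⇔ S (s , opposite v))
                       (Finₚ.opposite-involutive v) (f~S (s , opposite v)))
    (λ f~S (s , u) → subst (λ w → (opposite u ⪯ f s) ⇔ S (s , w))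
                           (Finₚ.opposite-involutive u) (f~S s (opposite u)))

  represents-cong : (∀ s → f s ≡ g s) → Represents g S → Represents f S
  represents-cong f≗g g~S (s , u) rewrite f≗g s = g~S (s , u)

  represents-update : ∀ X → RepresentsVal D E → Represents f S →
    RepresentsVal (D [ X ↦ f ]) (E [ X ↦ S ])
  represents-update X D~E f~S Y with Y ℕ.≟ X
  ... | yes _ = f~S
  ... | no  _ = D~E Y

  represents-empty : (∀ s → f s ≡ inf) → (∀ t → ¬ S t) → Represents f S
  represents-empty f≡∞ ¬S (s , u) rewrite f≡∞ s = mk⇔ (λ ()) (¬S (s , u))

  represents-full : (∀ s → f s ≡ val zero) → (∀ t → S t) → Represents f S
  represents-full f≡0 S-all (s , u) rewrite f≡0 s = mk⇔ (λ _ → S-all (s , u)) (λ _ → z≤n)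

  represents-min : Represents f S → Represents g S′ →
    Represents (λ s → minE (f s) (g s)) (λ t → S t ⊎ S′ t)
  represents-min {f} {g = g} f~S g~S′ (s , u) =
    ⇔.trans (⪯-minE (opposite u) (f s) (g s)) (f~S (s , u) ⊎-⇔ g~S′ (s , u))

  represents-max : Represents f S → Represents g S′ →
    Represents (λ s → maxE (f s) (g s)) (λ t → S t × S′ t)
  represents-max {f} {g = g} f~S g~S′ (s , u) =
    ⇔.trans (⪯-maxE (opposite u) (f s) (g s)) (f~S (s , u) ×-⇔ g~S′ (s , u))

  □* : (State* → Set) → State* → Set
  □* S t = Σ (Vec Bool nx) λ x′ → ρe* t x′ ×
    ((y′ : Vec Bool ny) (c₂ : Fin (suc c)) → ρs* t ((x′ , y′) , c₂) → S ((x′ , y′) , c₂))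

  □*-mono : (∀ t → S t → S′ t) → ∀ t → □* S t → □* S′ t
  □*-mono S⊆S′ t = map₂ (map₂ λ next y′ c₂ move → S⊆S′ _ (next y′ c₂ move))

  □*-cong : (∀ t → S t ⇔ S′ t) → ∀ t → □* S t ⇔ □* S′ t
  □*-cong S⇔S′ t = mk⇔ (□*-mono (to ∘ S⇔S′) t) (□*-mono (from ∘ S⇔S′) t)

  <E-EC : ∀ s x′ y′ (e : En c) (u : Fin (suc c)) → (toℕ u <E EC s (x′ , y′) e) ⇔
    (T (ρe s x′) × (∀ c₂ → ρs* (s , u) ((x′ , y′) , c₂) → toℕ c₂ <E e))
  <E-EC s x′ y′ e u with ρe s x′
  ... | false = mk⇔ (λ ()) (λ ())
  <E-EC s x′ y′ inf     u | true = mk⇔ (λ _ → tt , λ _ _ → tt) (λ _ → tt)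
  <E-EC s x′ y′ (val m) u | true with ρs s (x′ , y′)
  ... | false = mk⇔ (λ _ → tt , λ _ ()) (λ _ → tt)
  ... | true  =
    ⇔.trans (<E-clampE _ (Finₚ.toℕ≤pred[n] u))
      (⇔.trans (i<j-k⇔i+k<j (+ toℕ u) (+ toℕ m) (w s (x′ , y′)))
        (⇔.trans (i<m⇔Fin≤i⇒<m _ (Finₚ.toℕ≤pred[n] m))
          (mk⇔ (λ below → tt , λ k (_ , k≤) → below k k≤)
               (λ (_ , below) k k≤ → below k (tt , k≤)))))

  <E-minL-EC : ∀ (g : EF c nx ny) s x′ (u : Fin (suc c)) →
    (toℕ u <E minL (map (λ y′ → EC s (x′ , y′) (g (x′ , y′))) (allVecs ny))) ⇔
    (T (ρe s x′) × ((y′ : Vec Bool ny) (c₂ : Fin (suc c)) →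
                      ρs* (s , u) ((x′ , y′) , c₂) → toℕ c₂ <E g (x′ , y′)))
  <E-minL-EC g s x′ u =
    ⇔.trans (<E-foldr-minE (toℕ u) (λ y′ → EC s (x′ , y′) (g (x′ , y′))) (allVecs ny))
      (⇔.trans All-allVecs⇔∀
        (⇔.trans (Π-⇔ λ y′ → <E-EC s x′ y′ (g (x′ , y′)) u)
                 (Π-×-distrib (replicate ny false))))

  <E-ECpre : ∀ (g : EF c nx ny) s (u : Fin (suc c)) →
    (toℕ u <E ECpre g s) ⇔ □* (λ (s′ , c₂) → toℕ c₂ <E g s′) (s , u)
  <E-ECpre g s u =
    ⇔.trans (<E-foldr-maxE (toℕ u) minEC (allVecs nx))
      (⇔.trans Any-allVecs⇔∃ (Σ-⇔ (↠-id _) λ {x′} → <E-minL-EC g s x′ u))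
    where
    minEC : Vec Bool nx → En c
    minEC x′ = minL (map (λ y′ → EC s (x′ , y′) (g (x′ , y′))) (allVecs ny))

  represents-□ : Represents f S → Represents (λ s → ~ ECpre (λ s′ → ~ f s′) s) (□* S)
  represents-□ {f} f~S (s , u) =
    ⇔.trans (opposite⪯~⇔<E u _)
      (⇔.trans (<E-ECpre (λ s′ → ~ f s′) s u)
        (□*-cong (λ (s′ , c₂) → ⇔.trans (⇔.sym (opposite⪯⇔<E~ c₂ (f s′))) (f~S (s′ , c₂)))
                 (s , u)))

  represents-approximants : Represents (h 0) (I 0) → (∀ i → I (suc i) ≡ F (I i)) →
    (∀ i {J} → Represents (h i) J → Represents (h (suc i)) (F J)) →
    ∀ i → Represents (h i) (I i)
  represents-approximants h₀~I₀ I-suc step zero    = h₀~I₀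
  represents-approximants h₀~I₀ I-suc step (suc i) rewrite I-suc i =
    step i (represents-approximants h₀~I₀ I-suc step i)

  -- Both limits range over F (I i) = I (suc i): the approximants of ⟦ μ X φ ⟧ and ⟦ ν X φ ⟧
  -- are local to each state, and can only be inferred by unification through F.
  represents-μ : IsMin h f → (∀ s → h 0 s ≡ inf) → (∀ t → ¬ I 0 t) →
    (∀ i → I (suc i) ≡ F (I i)) → (∀ i {J} → Represents (h i) J → Represents (h (suc i)) (F J)) →
    Represents f (λ t → Σ ℕ λ i → F (I i) t)
  represents-μ {h} {f} {I} {F} isMin h₀≡∞ ¬I₀ I-suc step (s , u) = mk⇔ reach bound
    where
    approx : ∀ i → Represents (h (suc i)) (F (I i))
    approx i = step i (represents-approximants (represents-empty h₀≡∞ ¬I₀) I-suc step i)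
    reach : opposite u ⪯ f s → Σ ℕ λ i → F (I i) (s , u)
    reach f≼ with isMin s
    ... | (zero  , f≡h₀) , _ = ⊥-elim (subst (opposite u ⪯_) (trans f≡h₀ (h₀≡∞ s)) f≼)
    ... | (suc i , f≡h)  , _ = i , to (approx i (s , u)) (subst (opposite u ⪯_) f≡h f≼)
    bound : (Σ ℕ λ i → F (I i) (s , u)) → opposite u ⪯ f s
    bound (i , x) =
      ⪯-antitone (f s) (h (suc i) s) (proj₂ (isMin s) (suc i)) (from (approx i (s , u)) x)

  represents-ν : IsMax h f → (∀ s → h 0 s ≡ val zero) → (∀ t → I 0 t) →
    (∀ i → I (suc i) ≡ F (I i)) → (∀ i {J} → Represents (h i) J → Represents (h (suc i)) (F J)) →
    Represents f (λ t → (i : ℕ) → F (I i) t)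
  represents-ν {h} {f} {I} {F} isMax h₀≡0 I₀ I-suc step (s , u) = mk⇔ stay bound
    where
    approx : ∀ i → Represents (h (suc i)) (F (I i))
    approx i = step i (represents-approximants (represents-full h₀≡0 I₀) I-suc step i)
    stay : opposite u ⪯ f s → (i : ℕ) → F (I i) (s , u)
    stay f≼ i =
      to (approx i (s , u)) (⪯-antitone (h (suc i) s) (f s) (proj₂ (isMax s) (suc i)) f≼)
    bound : ((i : ℕ) → F (I i) (s , u)) → opposite u ⪯ f s
    bound x with isMax s
    ... | (zero  , f≡h₀) , _ = subst (opposite u ⪯_) (sym (trans f≡h₀ (h₀≡0 s))) z≤n
    ... | (suc i , f≡h)  , _ = subst (opposite u ⪯_) (sym f≡h) (from (approx i (s , u)) (x i))

  sem-represents : ∀ {ψ} → RepresentsVal D E → SemE ψ D f → Represents f (⟦ ψ ⟧ E)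
  sem-represents D~E (s-var {v} f≡) =
    represents-cong f≡ λ (s , u) → ⪯-if-zero-inf (opposite u) (s ⊨ v)
  sem-represents D~E (s-nvar {v} f≡) =
    represents-cong f≡ λ (s , u) → ⪯-if-inf-zero (opposite u) (s ⊨ v)
  sem-represents D~E (s-rvar {X} f≡) = represents-cong f≡ (D~E X)
  sem-represents D~E (s-or a b f≡) =
    represents-cong f≡ (represents-min (sem-represents D~E a) (sem-represents D~E b))
  sem-represents D~E (s-and a b f≡) =
    represents-cong f≡ (represents-max (sem-represents D~E a) (sem-represents D~E b))
  sem-represents D~E (s-box a f≡) = represents-cong f≡ (represents-□ (sem-represents D~E a))
  sem-represents D~E (s-mu {X} h h₀ step isMin) t =
    ⇔.trans (represents-μ isMin h₀ (λ _ ()) (λ _ → refl)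
               (λ i h~J → sem-represents (represents-update X D~E h~J) (step i)) t)
            (⇔.sym (Σℕ⇔Σℕ∘suc λ ()))
  sem-represents D~E (s-nu {X} h h₀ step isMax) t =
    ⇔.trans (represents-ν isMax h₀ (λ _ → tt) (λ _ → refl)
               (λ i h~J → sem-represents (represents-update X D~E h~J) (step i)) t)
            (⇔.sym (Πℕ⇔Πℕ∘suc tt))

lemma3p11 : {nx ny : ℕ} (G : WGS nx ny) (c : ℕ) (ψ : Formula nx ny)
    (D : ℕ → EF c nx ny) (E : ℕ → Star.State* c G → Set) →
    ((X : ℕ) (s : State nx ny) (v : Fin (suc c)) →
      (v ⪯ D X s) ⇔ E X (s , cminus v)) →
    (f : EF c nx ny) → Energy.SemE c G ψ D f →
    (s : State nx ny) (v : Fin (suc c)) →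
      (v ⪯ f s) ⇔ Star.⟦_⟧ c G ψ E (s , cminus v)
lemma3p11 G c ψ D E D~E f ψ-sem =
  to (represents⇔cminus c G)
     (sem-represents c G (λ X → from (represents⇔cminus c G) (D~E X)) ψ-sem)
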